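{- Let $f \in \mathbb{Z}[x]$ be a nonconstant polynomial and $p$ a prime not dividing every coefficient of $f$. With $f_2,\dots,f_\ell$, $\mathcal{L}_2,\dots,\mathcal{L}_\ell$ and $h_2$ as in the context, $$\#\{a\in\{0,1,\dots,p-1\} : \bar a \in V_p(\mathcal{L}_2\cdots\mathcal{L}_\ell),\ f(a)\not\equiv 0 \bmod p^2\} = \deg(f_2\cdots f_\ell)-\deg(h_2),$$ i.e. exactly this many degenerate roots of $f$ modulo $p$ fail to lift to roots of $f$ modulo $p^2$.
   Context: For a prime $p$ and $k\ge 1$, $\pi_{p^k}:\mathbb{Z}[x]\to(\mathbb{Z}/p^k\mathbb{Z})[x]$ denotes coefficientwise reduction mod $p^k$, and $\bar a$ denotes the class of $a\in\mathbb{Z}$ in $\mathbb{Z}/p\mathbb{Z}$. For $g\in(\mathbb{Z}/p^k\mathbb{Z})[x]$, $\widetilde{g}\in\mathbb{Z}[x]$ denotes the unique lift of $g$ all of whose coefficients lie in $\{0,1,\dots,p^k-1\}$. For $F\in\mathbb{Z}[x]$, $V_{p}(F)=\{\zeta\in\mathbb{Z}/p\mathbb{Z} : [\pi_{p}(F)](\zeta)=0\}$. Let $h_1=\pi_p(f)$. Let $\ell$ be the maximal multiplicity of a root of $h_1$ in $\mathbb{Z}/p\mathbb{Z}$ ($\ell=0$ if none). For $1\le i\le\ell$, $f_i=\prod(x-r)$ over the distinct roots $r\in\mathbb{Z}/p\mathbb{Z}$ of $h_1$ of multiplicity exactly $i$ (empty product $=1$), so $h_1=f_1f_2^2\cdots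 f_\ell^\ell g$ with $g\in(\mathbb{Z}/p\mathbb{Z})[x]$ having no roots in $\mathbb{Z}/p\mathbb{Z}$. Writing $f_i=\prod_j L_{i,j}$ as a product of distinct linear factors, $\mathcal{L}_i=\prod_j\widetilde{L_{i,j}}\in\mathbb{Z}[x]$ (lifts with $k=1$). Define $t=\pi_p\big[\tfrac1p\big(f-\widetilde g\prod_{i=1}^\ell\mathcal{L}_i^i\big)\big]\in(\mathbb{Z}/p\mathbb{Z})[x]$ and $h_2=\gcd(f_2\cdots f_\ell,\ t)$, the monic gcd in $(\mathbb{Z}/p\mathbb{Z})[x]$. -}

module Defs where

open import Data.Nat as ℕ using (ℕ; zero; suc; _≤_; _⊔_; _∸_; _^_)
open import Data.Nat.Divisibility using (_∣_; _∣?_)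
open import Data.Integer as ℤ using (ℤ; +_; -_; ∣_∣)
open import Data.Integer.DivMod using (_/ℕ_; _%ℕ_)
open import Data.Fin using (Fin; toℕ)
open import Data.List using (List; []; _∷_; map; foldr; filter; length; applyUpTo; allFin)
open import Data.Bool using (Bool; true; false; _∧_)
open import Data.Product using (Σ; ∃; _×_)
open import Relation.Nullary using (¬_; does)
open import Relation.Nullary.Decidable using (_×-dec_; ¬?)
open import Relation.Binary.PropositionalEquality using (_≡_)

-- Polynomials are coefficient lists, lowest degree first.
-- ℤ[x] : Poly, with the usual (list) operations.
-- (ℤ/pℤ)[x] is modelled by the same lists, taken up to the setoid
-- equality _≈[_]_ (coefficientwise congruence mod p, missing
-- coefficients are 0).

Poly : Set
Poly = List ℤ

coeff : Poly → ℕ → ℤ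
coeff []       n       = + 0
coeff (a ∷ as) zero    = a
coeff (a ∷ as) (suc n) = coeff as n

addP : Poly → Poly → Poly
addP []       q        = q
addP (a ∷ as) []       = a ∷ as
addP (a ∷ as) (b ∷ bs) = (a ℤ.+ b) ∷ addP as bs

scaleP : ℤ → Poly → Poly
scaleP c = map (c ℤ.*_)

mulP : Poly → Poly → Poly
mulP []       q = []
mulP (a ∷ as) q = addP (scaleP a q) (+ 0 ∷ mulP as q)

subP : Poly → Poly → Poly
subP f g = addP f (map -_ g)

oneP : Poly
oneP = + 1 ∷ []

powP : Poly → ℕ → Poly
powP q zero    = oneP
powP q (suc n) = mulP q (powP q n)

prodP : List Poly → Poly
prodP = foldr mulP oneP

evalP : Poly → ℤ → ℤ
evalP []       x = + 0
evalP (a ∷ as) x = a ℤ.+ x ℤ.* evalP as x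

NonConstant : Poly → Set
NonConstant f = ∃ λ n → 1 ≤ n × ¬ (coeff f n ≡ + 0)

reduce : ℕ → ℤ → ℤ
reduce zero    c = c
reduce (suc m) c = + (c %ℕ suc m)

divBy : ℕ → ℤ → ℤ
divBy zero    c = c
divBy (suc m) c = c /ℕ suc m

π : ℕ → Poly → Poly
π m f = map (reduce m) f

lift : ℕ → Poly → Poly
lift m g = map (reduce m) g

_≈[_]_ : Poly → ℕ → Poly → Set
f ≈[ p ] g = ∀ n → p ∣ ∣ coeff f n ℤ.- coeff g n ∣

Divides : ℕ → Poly → Poly → Set
Divides p d a = Σ Poly λ q → mulP d q ≈[ p ] a

isZeroMod : ℕ → ℤ → Bool
isZeroMod p c = does (p ∣? ∣ c ∣)

allZeroMod : ℕ → Poly → Bool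
allZeroMod p []       = true
allZeroMod p (c ∷ cs) = isZeroMod p c ∧ allZeroMod p cs

-- degree in (ℤ/pℤ)[x] (degree of the zero polynomial is set to 0)
degMod : ℕ → Poly → ℕ
degMod p []       = 0
degMod p (c ∷ cs) with allZeroMod p cs
... | true  = 0
... | false = suc (degMod p cs)

Monic : ℕ → Poly → Set
Monic p h = p ∣ ∣ coeff h (degMod p h) ℤ.- + 1 ∣

IsMonicGcd : ℕ → Poly → Poly → Poly → Set
IsMonicGcd p a b h =
  Monic p h × Divides p h a × Divides p h b ×
  (∀ d → Divides p d a → Divides p d b → Divides p d h)

linear : ℕ → Poly
linear r = - (+ r) ∷ + 1 ∷ []

IsMultiplicity : ℕ → Poly → ℕ → ℕ → Set
IsMultiplicity p h r m =
  Divides p (powP (linear r) m) h × ¬ Divides p (powP (linear r) (suc m)) h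

-- The data of the context, given p, f and the multiplicity function
-- mult : Fin p → ℕ of the roots of h₁ = π_p f.

module Context (p : ℕ) (f : Poly) (mult : Fin p → ℕ) where

  h₁ : Poly
  h₁ = π p f

  ℓ : ℕ
  ℓ = foldr _⊔_ 0 (map mult (allFin p))

  rootsOfMult : ℕ → List (Fin p)
  rootsOfMult i = filter (λ r → mult r ℕ.≟ i) (allFin p)

  fᵢ : ℕ → Poly
  fᵢ i = prodP (map (λ r → linear (toℕ r)) (rootsOfMult i))

  𝓛 : ℕ → Poly
  𝓛 i = prodP (map (λ r → lift p (linear (toℕ r))) (rootsOfMult i))

  oneToℓ : List ℕ
  oneToℓ = applyUpTo suc ℓ

  twoToℓ : List ℕ
  twoToℓ = applyUpTo (λ k → suc (suc k)) (ℓ ∸ 1)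

  fPowers : Poly
  fPowers = prodP (map (λ i → powP (fᵢ i) i) oneToℓ)

  𝓛Powers : Poly
  𝓛Powers = prodP (map (λ i → powP (𝓛 i) i) oneToℓ)

  f₂⋯fℓ : Poly
  f₂⋯fℓ = prodP (map fᵢ twoToℓ)

  𝓛₂⋯𝓛ℓ : Poly
  𝓛₂⋯𝓛ℓ = prodP (map 𝓛 twoToℓ)

  t : Poly → Poly
  t g = π p (map (divBy p) (subP f (mulP (lift p g) 𝓛Powers)))

  badRoot? : (a : ℕ) → _
  badRoot? a = (p ∣? ∣ evalP (π p 𝓛₂⋯𝓛ℓ) (+ a) ∣)
               ×-dec ¬? (p ^ 2 ∣? ∣ evalP f (+ a) ∣)

  badCount : ℕ
  badCount = length (filter badRoot? (applyUpTo (λ a → a) p))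

module Submission where

-- Write T for the polynomial with f = p·T + M, where M = g̃ 𝓛₁ 𝓛₂² ⋯ 𝓛_ℓ^ℓ is
-- congruent to f modulo p, so that t = π_p T.  At a root r of h₁ of
-- multiplicity i ≥ 2 the factor 𝓛_i^i makes M(r) divisible by p², hence
-- f(r) ≡ p·T(r) (mod p²) and r lifts to a root modulo p² iff p ∣ t(r).  The
-- roots of multiplicity ≥ 2 are exactly those of 𝓛₂ ⋯ 𝓛_ℓ modulo p, and
-- f₂ ⋯ f_ℓ is the product of the x - r over them.  Modulo a p-prime, the monic
-- gcd of a product of distinct linear factors with t is the product of the
-- factors whose root is a root of t, so its degree counts the degenerate roots
-- that do lift, and the count in the statement is the complement.

open import Defs
open import Data.Nat using (ℕ; _∸_)
open import Data.Nat.Divisibility using (_∣_)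
open import Data.Nat.Primality using (Prime)
open import Data.Integer using (∣_∣)
open import Data.Fin using (Fin; toℕ)
open import Relation.Nullary using (¬_)
open import Relation.Binary.PropositionalEquality using (_≡_)

open import Algebra.Bundles using (CommutativeMonoid)
import Algebra.Properties.CommutativeSemigroup
open import Data.Bool using (true; false)
open import Data.Empty using (⊥-elim)
open import Data.Fin using (fromℕ<)
import Data.Fin.Properties as Fin
open import Data.Integer.Base using (ℤ; +_; -_; _+_; _*_; _-_)
open import Data.Integer.DivMod using (_/ℕ_; _%ℕ_; a≡a%ℕn+[a/ℕn]*n; n%ℕd<d)
open import Data.Integer.Divisibility.Signed as ℤ∣ using (divides) renaming (_∣_ to _∣ᶻ_)
import Data.Integer.Properties as ℤ
open import Data.Integer.Tactic.RingSolver using (solve-∀)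
open import Data.List using (List; []; _∷_; _++_; concat; map; foldr; length; filter; upTo; allFin)
open import Data.List.Membership.Propositional using (_∈_; find)
open import Data.List.Membership.Propositional.Properties
  using (∈-map⁺; ∈-map⁻; ∈-filter⁺; ∈-filter⁻; ∈-allFin; ∈-applyUpTo⁺; ∈-applyUpTo⁻;
         ∈-concat⁺′; ∈-concat⁻′; ∈-upTo⁺; ∈-upTo⁻)
open import Data.List.Membership.Propositional.Properties.WithK using (unique∧set⇒bag)
open import Data.List.Properties using (length-map)
open import Data.List.Relation.Binary.BagAndSetEquality using (∼bag⇒↭)
open import Data.List.Relation.Binary.Permutation.Propositional.Properties using (↭-length)
open import Data.List.Relation.Unary.All as All using (All; []; _∷_)
import Data.List.Relation.Unary.All.Properties as All
open import Data.List.Relation.Unary.AllPairs using (AllPairs; []; _∷_)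
import Data.List.Relation.Unary.AllPairs as AllPairs
import Data.List.Relation.Unary.AllPairs.Properties as AllPairs
open import Data.List.Relation.Unary.Any using (Any; here; there)
open import Data.List.Relation.Unary.Unique.Propositional using (Unique)
import Data.List.Relation.Unary.Unique.Propositional.Properties as Unique
open import Data.Nat as ℕ using (zero; suc; _≤_; _<_; z≤n; s≤s; _⊔_; _^_)
import Data.Nat.Divisibility as ℕ
import Data.Nat.DivMod as ℕ
import Data.Nat.Primality as ℕ
import Data.Nat.Properties as ℕ
open import Data.Product using (Σ; _×_; _,_; proj₂)
open import Data.Sum using (_⊎_; inj₁; inj₂; [_,_]′)
open import Function using (_∘_; _⇔_; mk⇔; Equivalence)
open import Relation.Binary.Definitions using (tri<; tri≈; tri>)
open import Relation.Binary.PropositionalEquality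
  using (_≢_; refl; sym; trans; cong; cong₂; subst; _≗_; module ≡-Reasoning)
import Relation.Binary.Reasoning.Setoid
open import Relation.Binary.Structures using (IsEquivalence)
open import Relation.Nullary using (yes; no; Dec; ¬?)
open import Relation.Unary using (Decidable)

infix 4 _∣ℤ_ _≡[_]_

_∣ℤ_ : ℕ → ℤ → Set
m ∣ℤ a = + m ∣ᶻ a

record _≡[_]_ (a : ℤ) (m : ℕ) (b : ℤ) : Set where
  constructor by-difference
  field difference : m ∣ℤ a - b
open _≡[_]_ public

∣ℤ-resp-≡ : ∀ {m a b} → a ≡ b → m ∣ℤ a → m ∣ℤ b
∣ℤ-resp-≡ {m} = subst (m ∣ℤ_)

∣ℤ-zero : ∀ {m} → m ∣ℤ + 0
∣ℤ-zero {m} = divides (+ 0) (sym (ℤ.*-zeroˡ (+ m)))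

∣ℤ? : ∀ m a → Dec (m ∣ℤ a)
∣ℤ? m a = + m ℤ∣.∣? a

≡⇒≡-mod : ∀ {m a b} → a ≡ b → a ≡[ m ] b
≡⇒≡-mod {a = a} refl = by-difference (∣ℤ-resp-≡ (sym (ℤ.+-inverseʳ a)) ∣ℤ-zero)

mod-refl : ∀ {m} a → a ≡[ m ] a
mod-refl a = ≡⇒≡-mod refl

mod-sym : ∀ {m a b} → a ≡[ m ] b → b ≡[ m ] a
mod-sym {a = a} {b} (by-difference d) = by-difference (∣ℤ-resp-≡ (negate-difference a b) (ℤ∣.∣m⇒∣-m d))
  where
  negate-difference : ∀ a b → - (a - b) ≡ b - a
  negate-difference = solve-∀

mod-trans : ∀ {m a b c} → a ≡[ m ] b → b ≡[ m ] c → a ≡[ m ] c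
mod-trans {a = a} {b} {c} (by-difference d) (by-difference e) =
  by-difference (∣ℤ-resp-≡ (telescope a b c) (ℤ∣.∣m∣n⇒∣m+n d e))
  where
  telescope : ∀ a b c → (a - b) + (b - c) ≡ a - c
  telescope = solve-∀

+-cong-mod : ∀ {m a b c d} → a ≡[ m ] b → c ≡[ m ] d → a + c ≡[ m ] b + d
+-cong-mod {a = a} {b} {c} {d} (by-difference x) (by-difference y) =
  by-difference (∣ℤ-resp-≡ (regroup a b c d) (ℤ∣.∣m∣n⇒∣m+n x y))
  where
  regroup : ∀ a b c d → (a - b) + (c - d) ≡ (a + c) - (b + d)
  regroup = solve-∀

*-cong-mod : ∀ {m a b c d} → a ≡[ m ] b → c ≡[ m ] d → a * c ≡[ m ] b * d
*-cong-mod {a = a} {b} {c} {d} (by-difference x) (by-difference y) =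
  by-difference (∣ℤ-resp-≡ (regroup a b c d)
                            (ℤ∣.∣m∣n⇒∣m+n (ℤ∣.∣m⇒∣m*n c x) (ℤ∣.∣n⇒∣m*n b y)))
  where
  regroup : ∀ a b c d → (a - b) * c + b * (c - d) ≡ a * c - b * d
  regroup = solve-∀

∣ℤ⇒≡0 : ∀ {m a} → m ∣ℤ a → a ≡[ m ] + 0
∣ℤ⇒≡0 {a = a} d = by-difference (∣ℤ-resp-≡ (sym (ℤ.+-identityʳ a)) d)

≡0⇒∣ℤ : ∀ {m a} → a ≡[ m ] + 0 → m ∣ℤ a
≡0⇒∣ℤ {a = a} (by-difference d) = ∣ℤ-resp-≡ (ℤ.+-identityʳ a) d

∣ℤ-resp-mod : ∀ {m a b} → a ≡[ m ] b → m ∣ℤ b → m ∣ℤ a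
∣ℤ-resp-mod a≡b d = ≡0⇒∣ℤ (mod-trans a≡b (∣ℤ⇒≡0 d))

+-absorbʳ-mod : ∀ {m} x {y} → m ∣ℤ y → x + y ≡[ m ] x
+-absorbʳ-mod x {y} d = by-difference (∣ℤ-resp-≡ (sym (cancel x y)) d)
  where
  cancel : ∀ x y → x + y - x ≡ y
  cancel = solve-∀

+-absorbˡ-mod : ∀ {m} {y} x → m ∣ℤ y → y + x ≡[ m ] x
+-absorbˡ-mod {y = y} x d = mod-trans (≡⇒≡-mod (ℤ.+-comm y x)) (+-absorbʳ-mod x d)

∣ℤ⇒∣∣∣ : ∀ {m a} → m ∣ℤ a → m ∣ ∣ a ∣
∣ℤ⇒∣∣∣ = ℤ∣.∣⇒∣ᵤ

∣∣∣⇒∣ℤ : ∀ {m a} → m ∣ ∣ a ∣ → m ∣ℤ a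
∣∣∣⇒∣ℤ = ℤ∣.∣ᵤ⇒∣

∣ℤ-product-of-multiples : ∀ {m a b} → m ∣ℤ a → m ∣ℤ b → m ℕ.* m ∣ℤ a * b
∣ℤ-product-of-multiples {m} (divides a refl) (divides b refl) = divides (a * b) (begin
  a * + m * (b * + m)   ≡⟨ regroup a b (+ m) ⟩
  a * b * (+ m * + m)   ≡⟨ cong (a * b *_) (sym (ℤ.pos-* m m)) ⟩
  a * b * + (m ℕ.* m)   ∎)
  where
  open ≡-Reasoning
  regroup : ∀ a b m → a * m * (b * m) ≡ a * b * (m * m)
  regroup = solve-∀

∣ℤ-cancel-factor : ∀ {m} .{{_ : ℕ.NonZero m}} a → m ℕ.* m ∣ℤ + m * a → m ∣ℤ a
∣ℤ-cancel-factor {m} a d =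
  ∣∣∣⇒∣ℤ (ℕ.*-cancelˡ-∣ m (subst (m ℕ.* m ∣_) (ℤ.abs-* (+ m) a) (∣ℤ⇒∣∣∣ d)))

module _ {p : ℕ} (p-prime : Prime p) where

  prime-∣ℤ-* : ∀ a b → p ∣ℤ a * b → p ∣ℤ a ⊎ p ∣ℤ b
  prime-∣ℤ-* a b d with ℕ.euclidsLemma ∣ a ∣ ∣ b ∣ p-prime (subst (p ∣_) (ℤ.abs-* a b) (∣ℤ⇒∣∣∣ d))
  ... | inj₁ p∣a = inj₁ (∣∣∣⇒∣ℤ p∣a)
  ... | inj₂ p∣b = inj₂ (∣∣∣⇒∣ℤ p∣b)

  prime-∣ℤ-*ʳ : ∀ a b → ¬ p ∣ℤ a → p ∣ℤ a * b → p ∣ℤ b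
  prime-∣ℤ-*ʳ a b p∤a p∣ab =
    [ (λ p∣a → ⊥-elim (p∤a p∣a)) , (λ p∣b → p∣b) ]′ (prime-∣ℤ-* a b p∣ab)

  prime∤1 : ¬ p ∣ℤ + 1
  prime∤1 d = ℕ.nonTrivial⇒≢1 {{ℕ.prime⇒nonTrivial p-prime}} (ℕ.∣1⇒≡1 (∣ℤ⇒∣∣∣ d))

∣-below-modulus : ∀ {m n} → n < m → m ∣ n → n ≡ 0
∣-below-modulus {suc k} {n} n<m m∣n =
  trans (sym (ℕ.m<n⇒m%n≡m n<m)) (ℕ.n∣m⇒m%n≡0 n (suc k) m∣n)

residue-unique≤ : ∀ {m a b} → a < m → b ℕ.≤ a → m ∣ℤ + a - + b → a ≡ b
residue-unique≤ {m} {a} {b} a<m b≤a d = ℕ.≤-antisym (ℕ.m∸n≡0⇒m≤n a∸b≡0) b≤a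
  where
  a∸b≡0 : a ℕ.∸ b ≡ 0
  a∸b≡0 = ∣-below-modulus (ℕ.≤-<-trans (ℕ.m∸n≤m a b) a<m)
    (∣ℤ⇒∣∣∣ (∣ℤ-resp-≡ (trans (ℤ.m-n≡m⊖n a b) (ℤ.⊖-≥ b≤a)) d))

residue-unique : ∀ {m a b} → a < m → b < m → m ∣ℤ + a - + b → a ≡ b
residue-unique {m} {a} {b} a<m b<m d with ℕ.≤-total b a
... | inj₁ b≤a = residue-unique≤ a<m b≤a d
... | inj₂ a≤b = sym (residue-unique≤ b<m a≤b (difference (mod-sym {a = + a} {b = + b} (by-difference d))))

reduce-≡ : ∀ m c → reduce m c ≡[ m ] c
reduce-≡ zero    c = ≡⇒≡-mod refl
reduce-≡ (suc k) c = by-difference (∣ℤ-resp-≡ (difference≡ (a≡a%ℕn+[a/ℕn]*n c (suc k)))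
                                                (ℤ∣.∣m⇒∣-m (ℤ∣.∣n⇒∣m*n q (ℤ∣.∣-refl {+ suc k}))))
  where
  q : ℤ
  q = c /ℕ suc k
  -- c = r + q (k + 1), so r - c = - q (k + 1)
  cancel : ∀ r s → - s ≡ r - (r + s)
  cancel = solve-∀
  difference≡ : c ≡ + (c %ℕ suc k) + q * + suc k → - (q * + suc k) ≡ reduce (suc k) c - c
  difference≡ eq = trans (cancel (+ (c %ℕ suc k)) (q * + suc k)) (cong (_-_ (reduce (suc k) c)) (sym eq))

divBy-exact : ∀ m c → m ∣ℤ c → c ≡ + m * divBy m c
divBy-exact zero    c d = trans (ℤ∣.0∣⇒≡0 d) (sym (ℤ.*-zeroˡ c))
divBy-exact (suc k) c d = begin
  c                     ≡⟨ decomposition ⟩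
  + r + q * + suc k     ≡⟨ cong (λ x → + x + q * + suc k) r≡0 ⟩
  + 0 + q * + suc k     ≡⟨ ℤ.+-identityˡ _ ⟩
  q * + suc k           ≡⟨ ℤ.*-comm q (+ suc k) ⟩
  + suc k * q           ∎
  where
  open ≡-Reasoning
  q : ℤ
  q = c /ℕ suc k
  r : ℕ
  r = c %ℕ suc k
  decomposition : c ≡ + r + q * + suc k
  decomposition = a≡a%ℕn+[a/ℕn]*n c (suc k)
  r≡0 : r ≡ 0
  r≡0 = ∣-below-modulus (n%ℕd<d c (suc k))
    (∣ℤ⇒∣∣∣ {a = + r} (ℤ∣.∣m+n∣n⇒∣m (∣ℤ-resp-≡ decomposition d)
                                      (ℤ∣.∣n⇒∣m*n q (ℤ∣.∣-refl {+ suc k}))))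

Coeffs : Set
Coeffs = ℕ → ℤ

shift : Coeffs → Coeffs
shift A i = A (suc i)

infixl 7 _⋆_
_⋆_ : Coeffs → Coeffs → Coeffs
(A ⋆ B) zero    = A 0 * B 0
(A ⋆ B) (suc n) = A 0 * B (suc n) + (shift A ⋆ B) n

⋆-cong : ∀ {A A′ B B′} → A ≗ A′ → B ≗ B′ → A ⋆ B ≗ A′ ⋆ B′
⋆-cong A≗A′ B≗B′ zero    = cong₂ _*_ (A≗A′ 0) (B≗B′ 0)
⋆-cong A≗A′ B≗B′ (suc n) =
  cong₂ _+_ (cong₂ _*_ (A≗A′ 0) (B≗B′ (suc n))) (⋆-cong (A≗A′ ∘ suc) B≗B′ n)

⋆-cong-mod : ∀ {m A A′ B B′} → (∀ i → A i ≡[ m ] A′ i) → (∀ i → B i ≡[ m ] B′ i) →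
             ∀ n → (A ⋆ B) n ≡[ m ] (A′ ⋆ B′) n
⋆-cong-mod A≡A′ B≡B′ zero    = *-cong-mod (A≡A′ 0) (B≡B′ 0)
⋆-cong-mod A≡A′ B≡B′ (suc n) =
  +-cong-mod (*-cong-mod (A≡A′ 0) (B≡B′ (suc n))) (⋆-cong-mod (A≡A′ ∘ suc) B≡B′ n)

⋆-zeroˡ : ∀ {A} B → (∀ i → A i ≡ + 0) → ∀ n → (A ⋆ B) n ≡ + 0
⋆-zeroˡ B A≡0 zero    = trans (cong (_* B 0) (A≡0 0)) (ℤ.*-zeroˡ (B 0))
⋆-zeroˡ B A≡0 (suc n) =
  trans (cong₂ _+_ (trans (cong (_* B (suc n)) (A≡0 0)) (ℤ.*-zeroˡ (B (suc n))))
                   (⋆-zeroˡ B (A≡0 ∘ suc) n))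
        (ℤ.+-identityˡ (+ 0))

⋆-multipleˡ : ∀ {m A} B → (∀ i → m ∣ℤ A i) → ∀ n → m ∣ℤ (A ⋆ B) n
⋆-multipleˡ B m∣A zero    = ℤ∣.∣m⇒∣m*n (B 0) (m∣A 0)
⋆-multipleˡ B m∣A (suc n) =
  ℤ∣.∣m∣n⇒∣m+n (ℤ∣.∣m⇒∣m*n (B (suc n)) (m∣A 0)) (⋆-multipleˡ B (m∣A ∘ suc) n)

⋆-unfoldʳ : ∀ A B n → (A ⋆ B) (suc n) ≡ A (suc n) * B 0 + (A ⋆ shift B) n
⋆-unfoldʳ A B zero    = ℤ.+-comm (A 0 * B 1) (A 1 * B 0)
⋆-unfoldʳ A B (suc n) =
  trans (cong (_+_ (A 0 * B (suc (suc n)))) (⋆-unfoldʳ (shift A) B n))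
        (swap (A 0 * B (suc (suc n))) (A (suc (suc n)) * B 0) _)
  where
  swap : ∀ x y z → x + (y + z) ≡ y + (x + z)
  swap = solve-∀

⋆-comm : ∀ A B → A ⋆ B ≗ B ⋆ A
⋆-comm A B zero    = ℤ.*-comm (A 0) (B 0)
⋆-comm A B (suc n) =
  trans (cong₂ _+_ (ℤ.*-comm (A 0) (B (suc n))) (⋆-comm (shift A) B n))
        (sym (⋆-unfoldʳ B A n))

⋆-linearˡ : ∀ c A D B n → ((λ i → c * A i + D i) ⋆ B) n ≡ c * (A ⋆ B) n + (D ⋆ B) n
⋆-linearˡ c A D B zero    = distrib c (A 0) (D 0) (B 0)
  where
  distrib : ∀ c a d b → (c * a + d) * b ≡ c * (a * b) + d * b
  distrib = solve-∀
⋆-linearˡ c A D B (suc n) =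
  trans (cong (_+_ ((c * A 0 + D 0) * B (suc n))) (⋆-linearˡ c (shift A) (shift D) B n))
        (distrib c (A 0) (D 0) (B (suc n)) _ _)
  where
  distrib : ∀ c a d b x y → (c * a + d) * b + (c * x + y) ≡ c * (a * b + x) + (d * b + y)
  distrib = solve-∀

⋆-assoc : ∀ A B C → (A ⋆ B) ⋆ C ≗ A ⋆ (B ⋆ C)
⋆-assoc A B C zero    = ℤ.*-assoc (A 0) (B 0) (C 0)
⋆-assoc A B C (suc n) =
  trans (cong (_+_ (A 0 * B 0 * C (suc n)))
          (trans (⋆-linearˡ (A 0) (shift B) (shift A ⋆ B) C n)
                 (cong (_+_ (A 0 * (shift B ⋆ C) n)) (⋆-assoc (shift A) B C n))))
        (regroup (A 0) (B 0) (C (suc n)) _ _)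
  where
  regroup : ∀ a b c x y → a * b * c + (a * x + y) ≡ a * (b * c + x) + y
  regroup = solve-∀

coeff-addP : ∀ a b n → coeff (addP a b) n ≡ coeff a n + coeff b n
coeff-addP []      b       n       = sym (ℤ.+-identityˡ _)
coeff-addP (x ∷ a) []      n       = sym (ℤ.+-identityʳ _)
coeff-addP (x ∷ a) (y ∷ b) zero    = refl
coeff-addP (x ∷ a) (y ∷ b) (suc n) = coeff-addP a b n

coeff-map : ∀ (h : ℤ → ℤ) → h (+ 0) ≡ + 0 → ∀ a n → coeff (map h a) n ≡ h (coeff a n)
coeff-map h h0≡0 []      n       = sym h0≡0
coeff-map h h0≡0 (x ∷ a) zero    = refl
coeff-map h h0≡0 (x ∷ a) (suc n) = coeff-map h h0≡0 a n

coeff-scaleP : ∀ c a n → coeff (scaleP c a) n ≡ c * coeff a n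
coeff-scaleP c = coeff-map (c *_) (ℤ.*-zeroʳ c)

coeff-mulP : ∀ a b → coeff (mulP a b) ≗ coeff a ⋆ coeff b
coeff-mulP []      b n       = sym (⋆-zeroˡ (coeff b) (λ _ → refl) n)
coeff-mulP (x ∷ a) b zero    =
  trans (coeff-addP (scaleP x b) (+ 0 ∷ mulP a b) 0)
        (trans (ℤ.+-identityʳ _) (coeff-scaleP x b 0))
coeff-mulP (x ∷ a) b (suc n) =
  trans (coeff-addP (scaleP x b) (+ 0 ∷ mulP a b) (suc n))
        (cong₂ _+_ (coeff-scaleP x b (suc n)) (coeff-mulP a b n))

infix 4 _≋[_]_
record _≋[_]_ (a : Poly) (m : ℕ) (b : Poly) : Set where
  constructor coefficientwise
  field at : ∀ n → coeff a n ≡[ m ] coeff b n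
open _≋[_]_ public

-- ≋ is the relation _≈[_]_ of the statement, recast as a record so that its
-- endpoints can be inferred.
≋⇒≈ : ∀ {m a b} → a ≋[ m ] b → a ≈[ m ] b
≋⇒≈ a≋b n = ∣ℤ⇒∣∣∣ (difference (at a≋b n))

≈⇒≋ : ∀ {m a b} → a ≈[ m ] b → a ≋[ m ] b
≈⇒≋ a≈b = coefficientwise λ n → by-difference (∣∣∣⇒∣ℤ (a≈b n))

coeff-≡⇒≋ : ∀ {m a b} → coeff a ≗ coeff b → a ≋[ m ] b
coeff-≡⇒≋ a≗b = coefficientwise (≡⇒≡-mod ∘ a≗b)

≋-isEquivalence : ∀ m → IsEquivalence (λ a b → a ≋[ m ] b)
≋-isEquivalence m = record
  { refl  = λ {a} → coefficientwise λ n → mod-refl (coeff a n)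
  ; sym   = λ a≋b → coefficientwise (mod-sym ∘ at a≋b)
  ; trans = λ a≋b b≋c → coefficientwise λ n → mod-trans (at a≋b n) (at b≋c n)
  }

≋-refl : ∀ {m a} → a ≋[ m ] a
≋-refl = IsEquivalence.refl (≋-isEquivalence _)

≋-sym : ∀ {m a b} → a ≋[ m ] b → b ≋[ m ] a
≋-sym = IsEquivalence.sym (≋-isEquivalence _)

≋-trans : ∀ {m a b c} → a ≋[ m ] b → b ≋[ m ] c → a ≋[ m ] c
≋-trans = IsEquivalence.trans (≋-isEquivalence _)

mulP-cong : ∀ {m a a′ b b′} → a ≋[ m ] a′ → b ≋[ m ] b′ → mulP a b ≋[ m ] mulP a′ b′
mulP-cong {m} {a} {a′} {b} {b′} a≋a′ b≋b′ = coefficientwise λ n →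
  mod-trans (≡⇒≡-mod (coeff-mulP a b n))
    (mod-trans (⋆-cong-mod (at a≋a′) (at b≋b′) n) (≡⇒≡-mod (sym (coeff-mulP a′ b′ n))))

mulP-congˡ : ∀ {m} a {b b′} → b ≋[ m ] b′ → mulP a b ≋[ m ] mulP a b′
mulP-congˡ a = mulP-cong (≋-refl {a = a})

mulP-congʳ : ∀ {m} b {a a′} → a ≋[ m ] a′ → mulP a b ≋[ m ] mulP a′ b
mulP-congʳ b a≋a′ = mulP-cong a≋a′ (≋-refl {a = b})

mulP-comm : ∀ {m} a b → mulP a b ≋[ m ] mulP b a
mulP-comm a b = coeff-≡⇒≋ λ n →
  trans (coeff-mulP a b n) (trans (⋆-comm (coeff a) (coeff b) n) (sym (coeff-mulP b a n)))

mulP-assoc : ∀ {m} a b c → mulP (mulP a b) c ≋[ m ] mulP a (mulP b c)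
mulP-assoc a b c = coeff-≡⇒≋ λ n → begin
  coeff (mulP (mulP a b) c) n           ≡⟨ coeff-mulP (mulP a b) c n ⟩
  (coeff (mulP a b) ⋆ coeff c) n        ≡⟨ ⋆-cong (coeff-mulP a b) (λ _ → refl) n ⟩
  ((coeff a ⋆ coeff b) ⋆ coeff c) n     ≡⟨ ⋆-assoc (coeff a) (coeff b) (coeff c) n ⟩
  (coeff a ⋆ (coeff b ⋆ coeff c)) n     ≡⟨ ⋆-cong (λ _ → refl) (sym ∘ coeff-mulP b c) n ⟩
  (coeff a ⋆ coeff (mulP b c)) n        ≡⟨ sym (coeff-mulP a (mulP b c) n) ⟩
  coeff (mulP a (mulP b c)) n           ∎
  where open ≡-Reasoning

oneP⋆ : ∀ B → coeff oneP ⋆ B ≗ B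
oneP⋆ B zero    = ℤ.*-identityˡ (B 0)
oneP⋆ B (suc n) = trans (cong₂ _+_ (ℤ.*-identityˡ (B (suc n))) (⋆-zeroˡ B (λ _ → refl) n))
                        (ℤ.+-identityʳ _)

mulP-identityˡ : ∀ {m} a → mulP oneP a ≋[ m ] a
mulP-identityˡ a = coeff-≡⇒≋ λ n → trans (coeff-mulP oneP a n) (oneP⋆ (coeff a) n)

polyMod-*-commutativeMonoid : ℕ → CommutativeMonoid _ _
polyMod-*-commutativeMonoid m = record
  { Carrier = Poly
  ; _≈_     = λ a b → a ≋[ m ] b
  ; _∙_     = mulP
  ; ε       = oneP
  ; isCommutativeMonoid = record
    { isMonoid = record
      { isSemigroup = record
        { isMagma = record { isEquivalence = ≋-isEquivalence m ; ∙-cong = mulP-cong }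
        ; assoc   = mulP-assoc }
      ; identity = mulP-identityˡ , λ a → ≋-trans (mulP-comm a oneP) (mulP-identityˡ a) }
    ; comm = mulP-comm }
  }

module ≋-Reasoning (m : ℕ) =
  Relation.Binary.Reasoning.Setoid (CommutativeMonoid.setoid (polyMod-*-commutativeMonoid m))
module mulP-Properties (m : ℕ) =
  Algebra.Properties.CommutativeSemigroup
    (CommutativeMonoid.commutativeSemigroup (polyMod-*-commutativeMonoid m))

π-≋ : ∀ m a → π m a ≋[ m ] a
π-≋ m a = coefficientwise λ n →
  mod-trans (≡⇒≡-mod (coeff-map (reduce m) (reduce-zero m) a n)) (reduce-≡ m (coeff a n))
  where
  reduce-zero : ∀ m → reduce m (+ 0) ≡ + 0
  reduce-zero zero    = refl
  reduce-zero (suc m) = refl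

prodP-map-cong : ∀ {m} {X : Set} {F G : X → Poly} → (∀ x → F x ≋[ m ] G x) →
                 ∀ L → prodP (map F L) ≋[ m ] prodP (map G L)
prodP-map-cong F≋G []      = ≋-refl
prodP-map-cong F≋G (x ∷ L) = mulP-cong (F≋G x) (prodP-map-cong F≋G L)

powP-cong : ∀ {m a b} → a ≋[ m ] b → ∀ k → powP a k ≋[ m ] powP b k
powP-cong a≋b zero    = ≋-refl
powP-cong a≋b (suc k) = mulP-cong a≋b (powP-cong a≋b k)

evalP-addP : ∀ a b x → evalP (addP a b) x ≡ evalP a x + evalP b x
evalP-addP []      b       x = sym (ℤ.+-identityˡ _)
evalP-addP (y ∷ a) []      x = sym (ℤ.+-identityʳ _)
evalP-addP (y ∷ a) (z ∷ b) x =
  trans (cong (λ v → y + z + x * v) (evalP-addP a b x)) (regroup y z x _ _)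
  where
  regroup : ∀ a b x c d → a + b + x * (c + d) ≡ (a + x * c) + (b + x * d)
  regroup = solve-∀

evalP-scaleP : ∀ c a x → evalP (scaleP c a) x ≡ c * evalP a x
evalP-scaleP c []      x = sym (ℤ.*-zeroʳ c)
evalP-scaleP c (y ∷ a) x =
  trans (cong (λ v → c * y + x * v) (evalP-scaleP c a x)) (regroup c y x _)
  where
  regroup : ∀ c a x b → c * a + x * (c * b) ≡ c * (a + x * b)
  regroup = solve-∀

evalP-neg : ∀ a x → evalP (map -_ a) x ≡ - evalP a x
evalP-neg []      x = refl
evalP-neg (c ∷ a) x = trans (cong (λ v → - c + x * v) (evalP-neg a x)) (regroup c x (evalP a x))
  where
  regroup : ∀ c x e → - c + x * (- e) ≡ - (c + x * e)
  regroup = solve-∀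

evalP-subP : ∀ a b x → evalP (subP a b) x ≡ evalP a x - evalP b x
evalP-subP a b x = trans (evalP-addP a (map -_ b) x) (cong (_+_ (evalP a x)) (evalP-neg b x))

evalP-mulP : ∀ a b x → evalP (mulP a b) x ≡ evalP a x * evalP b x
evalP-mulP []      b x = sym (ℤ.*-zeroˡ (evalP b x))
evalP-mulP (y ∷ a) b x = begin
  evalP (addP (scaleP y b) (+ 0 ∷ mulP a b)) x         ≡⟨ evalP-addP (scaleP y b) (+ 0 ∷ mulP a b) x ⟩
  evalP (scaleP y b) x + (+ 0 + x * evalP (mulP a b) x) ≡⟨ cong₂ (λ u v → u + (+ 0 + x * v))
                                                             (evalP-scaleP y b x) (evalP-mulP a b x) ⟩
  y * evalP b x + (+ 0 + x * (evalP a x * evalP b x))  ≡⟨ regroup y x (evalP a x) (evalP b x) ⟩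
  (y + x * evalP a x) * evalP b x                      ∎
  where
  open ≡-Reasoning
  regroup : ∀ a x A B → a * B + (+ 0 + x * (A * B)) ≡ (a + x * A) * B
  regroup = solve-∀

evalP-cong : ∀ {m a b} x → a ≋[ m ] b → evalP a x ≡[ m ] evalP b x
evalP-cong {m} {a} {b} x a≋b = go a b (at a≋b)
  where
  -- A missing list is read as the zero polynomial, whose Horner form is 0 + x * 0.
  zero-horner : + 0 ≡ + 0 + x * + 0
  zero-horner = sym (trans (ℤ.+-identityˡ (x * + 0)) (ℤ.*-zeroʳ x))
  horner : ∀ {c d u v} → c ≡[ m ] d → u ≡[ m ] v → c + x * u ≡[ m ] d + x * v
  horner c≡d u≡v = +-cong-mod c≡d (*-cong-mod (mod-refl x) u≡v)
  go : ∀ a b → (∀ n → coeff a n ≡[ m ] coeff b n) → evalP a x ≡[ m ] evalP b x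
  go []       []       _ = mod-refl _
  go []       (b ∷ bs) h = mod-trans (≡⇒≡-mod zero-horner) (horner (h 0) (go [] bs (h ∘ suc)))
  go (a ∷ as) []       h = mod-trans (horner (h 0) (go as [] (h ∘ suc))) (≡⇒≡-mod (sym zero-horner))
  go (a ∷ as) (b ∷ bs) h = horner (h 0) (go as bs (h ∘ suc))

evalP-linear : ∀ s x → evalP (linear s) x ≡ x - + s
evalP-linear s x = regroup x (+ s)
  where
  regroup : ∀ x s → - s + x * (+ 1 + x * + 0) ≡ x - s
  regroup = solve-∀

evalP-oneP : ∀ x → evalP oneP x ≡ + 1
evalP-oneP x = cong (_+_ (+ 1)) (ℤ.*-zeroʳ x)

evalP-prodP-∣ℤ : ∀ {m x P} Ps → P ∈ Ps → m ∣ℤ evalP P x → m ∣ℤ evalP (prodP Ps) x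
evalP-prodP-∣ℤ {x = x} (P ∷ Ps) (here refl) d =
  ∣ℤ-resp-≡ (sym (evalP-mulP P (prodP Ps) x)) (ℤ∣.∣m⇒∣m*n (evalP (prodP Ps) x) d)
evalP-prodP-∣ℤ {x = x} (Q ∷ Ps) (there P∈Ps) d =
  ∣ℤ-resp-≡ (sym (evalP-mulP Q (prodP Ps) x)) (ℤ∣.∣n⇒∣m*n (evalP Q x) (evalP-prodP-∣ℤ Ps P∈Ps d))

evalP-divBy : ∀ m a x → (∀ n → m ∣ℤ coeff a n) → evalP a x ≡ + m * evalP (map (divBy m) a) x
evalP-divBy m []       x _   = sym (ℤ.*-zeroʳ (+ m))
evalP-divBy m (c ∷ cs) x m∣a = begin
  c + x * evalP cs x
    ≡⟨ cong₂ (λ u v → u + x * v) (divBy-exact m c (m∣a 0)) (evalP-divBy m cs x (m∣a ∘ suc)) ⟩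
  + m * divBy m c + x * (+ m * evalP (map (divBy m) cs) x)
    ≡⟨ regroup (+ m) (divBy m c) x _ ⟩
  + m * (divBy m c + x * evalP (map (divBy m) cs) x)
    ∎
  where
  open ≡-Reasoning
  regroup : ∀ m c x e → m * c + x * (m * e) ≡ m * (c + x * e)
  regroup = solve-∀

evalP-powP-square : ∀ {m} Q {k} x → 2 ≤ k → m ∣ℤ evalP Q x → m ℕ.* m ∣ℤ evalP (powP Q k) x
evalP-powP-square Q {suc zero}    x (s≤s ()) _
evalP-powP-square Q {suc (suc k)} x _ m∣Q[x] =
  ∣ℤ-resp-≡ (sym (trans (evalP-mulP Q _ x) (cong (evalP Q x *_) (evalP-mulP Q (powP Q k) x))))
    (∣ℤ-resp-≡ (ℤ.*-assoc (evalP Q x) (evalP Q x) _)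
      (ℤ∣.∣m⇒∣m*n _ (∣ℤ-product-of-multiples m∣Q[x] m∣Q[x])))

coeff-linear-mulP : ∀ s q n →
  coeff (mulP (linear s) q) (suc n) ≡ - (+ s) * coeff q (suc n) + coeff q n
coeff-linear-mulP s q n =
  trans (coeff-mulP (linear s) q (suc n)) (cong (_+_ (- (+ s) * coeff q (suc n))) (oneP⋆ (coeff q) n))

-- (x - s)(c + x q) = x ((x - s) q + c) - s c, read off at the coefficient of x^(n+1).
linear-mulP-cons : ∀ s c q n →
  coeff (mulP (linear s) (c ∷ q)) (suc n) ≡ coeff (mulP (linear s) q) n + coeff (c ∷ []) n
linear-mulP-cons s c q zero    =
  trans (coeff-linear-mulP s (c ∷ q) 0) (cong (_+ c) (sym (coeff-mulP (linear s) q 0)))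
linear-mulP-cons s c q (suc n) =
  trans (coeff-linear-mulP s (c ∷ q) (suc n))
        (trans (sym (coeff-linear-mulP s q n)) (sym (ℤ.+-identityʳ _)))

coeff-mulP-zeroʳ : ∀ a n → coeff (mulP a []) n ≡ + 0
coeff-mulP-zeroʳ a n =
  trans (coeff-mulP a [] n) (trans (⋆-comm (coeff a) (coeff []) n) (⋆-zeroˡ (coeff a) (λ _ → refl) n))

quotient : ℕ → Poly → Poly
quotient s []       = []
quotient s (a ∷ as) = evalP as (+ s) ∷ quotient s as

synthetic-division : ∀ s h n →
  coeff h n ≡ coeff (mulP (linear s) (quotient s h)) n + coeff (evalP h (+ s) ∷ []) n
synthetic-division s [] n =
  sym (trans (cong (_+ coeff (+ 0 ∷ []) n) (coeff-mulP-zeroʳ (linear s) n)) (zero-constant n))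
  where
  zero-constant : ∀ n → + 0 + coeff (+ 0 ∷ []) n ≡ + 0
  zero-constant zero    = refl
  zero-constant (suc n) = refl
synthetic-division s (a ∷ as) zero    =
  trans (regroup a (+ s) (evalP as (+ s)))
        (cong (_+ (a + + s * evalP as (+ s))) (sym (coeff-mulP (linear s) (quotient s (a ∷ as)) 0)))
  where
  regroup : ∀ a s c → a ≡ - s * c + (a + s * c)
  regroup = solve-∀
synthetic-division s (a ∷ as) (suc n) = begin
  coeff as n                                                           ≡⟨ synthetic-division s as n ⟩
  coeff (mulP (linear s) (quotient s as)) n + coeff (evalP as (+ s) ∷ []) n
                                                                       ≡⟨ sym (linear-mulP-cons s _ (quotient s as) n) ⟩
  coeff (mulP (linear s) (quotient s (a ∷ as))) (suc n)               ≡⟨ sym (ℤ.+-identityʳ _) ⟩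
  coeff (mulP (linear s) (quotient s (a ∷ as))) (suc n) + + 0         ∎
  where open ≡-Reasoning

factor-theorem : ∀ {m} s h → m ∣ℤ evalP h (+ s) → h ≋[ m ] mulP (linear s) (quotient s h)
factor-theorem {m} s h m∣h[s] = coefficientwise λ n →
  mod-trans (≡⇒≡-mod (synthetic-division s h n))
            (+-absorbʳ-mod (coeff (mulP (linear s) (quotient s h)) n) (remainder n))
  where
  remainder : ∀ n → m ∣ℤ coeff (evalP h (+ s) ∷ []) n
  remainder zero    = m∣h[s]
  remainder (suc n) = ∣ℤ-zero

evalP-linear-root : ∀ s → evalP (linear s) (+ s) ≡ + 0
evalP-linear-root s = trans (evalP-linear s (+ s)) (ℤ.+-inverseʳ (+ s))

root-of-multiple : ∀ {m} s {h} w → h ≋[ m ] mulP (linear s) w → m ∣ℤ evalP h (+ s)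
root-of-multiple s {h} w h≋ = ∣ℤ-resp-mod (evalP-cong (+ s) h≋)
  (∣ℤ-resp-≡ (sym (trans (evalP-mulP (linear s) w (+ s)) (cong (_* evalP w (+ s)) (evalP-linear-root s))))
             (ℤ∣.∣m⇒∣m*n (evalP w (+ s)) ∣ℤ-zero))

coeff-beyond-length : ∀ a n → length a ℕ.≤ n → coeff a n ≡ + 0
coeff-beyond-length []      n       _         = refl
coeff-beyond-length (x ∷ a) (suc n) (s≤s len≤n) = coeff-beyond-length a n len≤n

-- x - s is not a zero divisor modulo m: the difference D of u and v satisfies
-- D_n ≡ s D_(n+1), and vanishes beyond both lengths, so it vanishes everywhere.
linear-cancel : ∀ {m} s u v → mulP (linear s) u ≋[ m ] mulP (linear s) v → u ≋[ m ] v
linear-cancel {m} s u v e = coefficientwise λ n →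
  by-difference (descend (length u ℕ.+ length v) n (ℕ.m≤n+m _ n))
  where
  D : ℕ → ℤ
  D n = coeff u n - coeff v n
  regroup : ∀ s u₁ u v₁ v → (- s * u₁ + u) - (- s * v₁ + v) + s * (u₁ - v₁) ≡ u - v
  regroup = solve-∀
  step : ∀ n → m ∣ℤ D (suc n) → m ∣ℤ D n
  step n d = ∣ℤ-resp-≡ (regroup (+ s) (coeff u (suc n)) (coeff u n) (coeff v (suc n)) (coeff v n))
    (ℤ∣.∣m∣n⇒∣m+n (∣ℤ-resp-≡ (cong₂ _-_ (coeff-linear-mulP s u n) (coeff-linear-mulP s v n))
                             (difference (at e (suc n))))
                  (ℤ∣.∣n⇒∣m*n (+ s) d))
  descend : ∀ k n → length u ℕ.+ length v ℕ.≤ n ℕ.+ k → m ∣ℤ D n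
  descend zero    n len≤n = ∣ℤ-resp-≡ (sym (cong₂ _-_
    (coeff-beyond-length u n (ℕ.≤-trans (ℕ.m≤m+n (length u) (length v)) len≤n′))
    (coeff-beyond-length v n (ℕ.≤-trans (ℕ.m≤n+m (length v) (length u)) len≤n′)))) ∣ℤ-zero
    where len≤n′ = subst (length u ℕ.+ length v ℕ.≤_) (ℕ.+-identityʳ n) len≤n
  descend (suc k) n len≤n = step n (descend k (suc n) (subst (length u ℕ.+ length v ℕ.≤_) (ℕ.+-suc n k) len≤n))

Vanishes : ℕ → Poly → Set
Vanishes m a = ∀ n → m ∣ℤ coeff a n

record HasDegree (m : ℕ) (a : Poly) (d : ℕ) : Set where
  constructor has-degree
  field
    leading : ¬ m ∣ℤ coeff a d
    above   : ∀ j → d < j → m ∣ℤ coeff a j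

degree-unique : ∀ {m a d d′} → HasDegree m a d → HasDegree m a d′ → d ≡ d′
degree-unique {d = d} {d′} (has-degree lead above) (has-degree lead′ above′) with ℕ.<-cmp d d′
... | tri< d<d′ _ _ = ⊥-elim (lead′ (above d′ d<d′))
... | tri≈ _ d≡d′ _ = d≡d′
... | tri> _ _ d′<d = ⊥-elim (lead (above′ d d′<d))

degree-resp-≋ : ∀ {m a b d} → a ≋[ m ] b → HasDegree m a d → HasDegree m b d
degree-resp-≋ a≋b (has-degree lead above) = has-degree
  (λ m∣b → lead (∣ℤ-resp-mod (at a≋b _) m∣b))
  (λ j d<j → ∣ℤ-resp-mod (mod-sym (at a≋b j)) (above j d<j))

degree⇒nonvanishing : ∀ {m a d} → HasDegree m a d → ¬ Vanishes m a
degree⇒nonvanishing (has-degree lead _) vanishes = lead (vanishes _)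

allZeroMod-true : ∀ m cs → allZeroMod m cs ≡ true → Vanishes m cs
allZeroMod-true m []       _  n = ∣ℤ-zero
allZeroMod-true m (c ∷ cs) eq n with m ℕ.∣? ∣ c ∣ | allZeroMod m cs in eq′
allZeroMod-true m (c ∷ cs) eq zero    | yes m∣c | true = ∣∣∣⇒∣ℤ m∣c
allZeroMod-true m (c ∷ cs) eq (suc n) | yes m∣c | true = allZeroMod-true m cs eq′ n

allZeroMod-false : ∀ m cs → allZeroMod m cs ≡ false → ¬ Vanishes m cs
allZeroMod-false m (c ∷ cs) eq vanishes with m ℕ.∣? ∣ c ∣ | allZeroMod m cs in eq′
... | yes _   | false = allZeroMod-false m cs eq′ (vanishes ∘ suc)
... | no  m∤c | _     = m∤c (∣ℤ⇒∣∣∣ (vanishes 0))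

degMod-correct : ∀ m a → ¬ Vanishes m a → HasDegree m a (degMod m a)
degMod-correct m []       nonzero = ⊥-elim (nonzero (λ _ → ∣ℤ-zero))
degMod-correct m (c ∷ cs) nonzero with allZeroMod m cs in eq
... | true  = has-degree (λ m∣c → nonzero λ { zero → m∣c ; (suc n) → allZeroMod-true m cs eq n })
                         (λ { (suc j) _ → allZeroMod-true m cs eq j })
... | false = let has-degree lead above = degMod-correct m cs (allZeroMod-false m cs eq) in
              has-degree lead (λ { (suc j) (s≤s d<j) → above j d<j })

⋆-top : ∀ {m} a b A B → (∀ i → a < i → m ∣ℤ A i) → (∀ j → b < j → m ∣ℤ B j) →
        (A ⋆ B) (a ℕ.+ b) ≡[ m ] A a * B b × (∀ j → a ℕ.+ b < j → m ∣ℤ (A ⋆ B) j)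
⋆-top {m} zero b A B A-above B-above =
  lowest b , λ j b<j → ∣ℤ-resp-mod (lowest j) (ℤ∣.∣n⇒∣m*n (A 0) (B-above j b<j))
  where
  lowest : ∀ j → (A ⋆ B) j ≡[ m ] A 0 * B j
  lowest zero    = mod-refl _
  lowest (suc j) = +-absorbʳ-mod (A 0 * B (suc j)) (⋆-multipleˡ B (λ i → A-above (suc i) (s≤s z≤n)) j)
⋆-top (suc a) b A B A-above B-above =
  let (top , above) = ⋆-top a b (shift A) B (λ i a<i → A-above (suc i) (s≤s a<i)) B-above in
  mod-trans (+-absorbˡ-mod _ (ℤ∣.∣n⇒∣m*n (A 0) (B-above (suc (a ℕ.+ b)) (s≤s (ℕ.m≤n+m b a))))) top ,
  λ { (suc j) (s≤s a+b<j) →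
        ℤ∣.∣m∣n⇒∣m+n
          (ℤ∣.∣n⇒∣m*n (A 0) (B-above (suc j) (s≤s (ℕ.≤-trans (ℕ.m≤n+m b a) (ℕ.<⇒≤ a+b<j)))))
                     (above j a+b<j) }

module _ {p : ℕ} (p-prime : Prime p) where

  degree-mulP : ∀ {a b da db} → HasDegree p a da → HasDegree p b db → HasDegree p (mulP a b) (da ℕ.+ db)
  degree-mulP {a} {b} {da} {db} (has-degree lead-a above-a) (has-degree lead-b above-b) =
    let (top , above) = ⋆-top da db (coeff a) (coeff b) above-a above-b in
    has-degree (λ p∣top → [ lead-a , lead-b ]′ (prime-∣ℤ-* p-prime _ _
                  (∣ℤ-resp-mod (mod-sym top) (∣ℤ-resp-≡ (coeff-mulP a b (da ℕ.+ db)) p∣top))))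
    (λ j lt → ∣ℤ-resp-≡ (sym (coeff-mulP a b j)) (above j lt))

  degree-oneP : HasDegree p oneP 0
  degree-oneP = has-degree (prime∤1 p-prime) λ { (suc j) _ → ∣ℤ-zero }

  degree-linear : ∀ s → HasDegree p (linear s) 1
  degree-linear s = has-degree (prime∤1 p-prime) λ { (suc (suc j)) _ → ∣ℤ-zero ; (suc zero) (s≤s ()) }

  degree-≤-of-divisor : ∀ {a u b da db} → HasDegree p a da → HasDegree p b db →
                        mulP a u ≋[ p ] b → da ℕ.≤ db
  degree-≤-of-divisor {a} {u} {b} {da} {db} deg-a deg-b au≋b =
    subst (da ℕ.≤_) (degree-unique (degree-resp-≋ au≋b deg-au) deg-b) (ℕ.m≤m+n da (degMod p u))
    where
    u-nonzero : ¬ Vanishes p u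
    u-nonzero vanishes = degree⇒nonvanishing deg-b λ n →
      ∣ℤ-resp-mod (mod-sym (at au≋b n))
        (∣ℤ-resp-≡ (sym (coeff-mulP a u n))
          (∣ℤ-resp-≡ (⋆-comm (coeff u) (coeff a) n) (⋆-multipleˡ (coeff a) vanishes n)))
    deg-au : HasDegree p (mulP a u) (da ℕ.+ degMod p u)
    deg-au = degree-mulP deg-a (degMod-correct p u u-nonzero)

  monic⇒nonvanishing : ∀ {h} → Monic p h → ¬ Vanishes p h
  monic⇒nonvanishing {h} monic vanishes =
    prime∤1 p-prime (∣ℤ-resp-≡ (cancel (coeff h (degMod p h)))
                               (ℤ∣.∣m∣n⇒∣m-n (vanishes (degMod p h)) (∣∣∣⇒∣ℤ monic)))
    where
    cancel : ∀ c → c - (c - + 1) ≡ + 1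
    cancel = solve-∀

peel-from-divisor : ∀ {m} s {d q P} → m ∣ℤ evalP d (+ s) →
  mulP d q ≋[ m ] mulP (linear s) P → mulP (quotient s d) q ≋[ m ] P
peel-from-divisor {m} s {d} {q} {P} m∣d[s] dq≋ = linear-cancel s (mulP (quotient s d) q) P (begin
  mulP (linear s) (mulP (quotient s d) q)     ≈⟨ ≋-sym (mulP-assoc (linear s) (quotient s d) q) ⟩
  mulP (mulP (linear s) (quotient s d)) q     ≈⟨ mulP-congʳ q (≋-sym (factor-theorem s d m∣d[s])) ⟩
  mulP d q                                    ≈⟨ dq≋ ⟩
  mulP (linear s) P                           ∎)
  where open ≋-Reasoning m

restore-in-divisor : ∀ {m} s {d w Q} → m ∣ℤ evalP d (+ s) →
  mulP (quotient s d) w ≋[ m ] Q → mulP d w ≋[ m ] mulP (linear s) Q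
restore-in-divisor {m} s {d} {w} {Q} m∣d[s] d′w≋ = begin
  mulP d w                                  ≈⟨ mulP-congʳ w (factor-theorem s d m∣d[s]) ⟩
  mulP (mulP (linear s) (quotient s d)) w   ≈⟨ mulP-assoc (linear s) (quotient s d) w ⟩
  mulP (linear s) (mulP (quotient s d) w)   ≈⟨ mulP-congˡ (linear s) d′w≋ ⟩
  mulP (linear s) Q                         ∎
  where open ≋-Reasoning m

restore-in-cofactor : ∀ {m} s {d w Q} → mulP d w ≋[ m ] Q → mulP d (mulP (linear s) w) ≋[ m ] mulP (linear s) Q
restore-in-cofactor {m} s {d} {w} {Q} dw≋ = begin
  mulP d (mulP (linear s) w)   ≈⟨ mulP-Properties.x∙yz≈y∙xz m d (linear s) w ⟩
  mulP (linear s) (mulP d w)   ≈⟨ mulP-congˡ (linear s) dw≋ ⟩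
  mulP (linear s) Q            ∎
  where open ≋-Reasoning m

module _ {p : ℕ} (p-prime : Prime p) where
  open ≋-Reasoning p

  peel-from-cofactor : ∀ s {d q P} → ¬ p ∣ℤ evalP d (+ s) →
    mulP d q ≋[ p ] mulP (linear s) P → mulP d (quotient s q) ≋[ p ] P
  peel-from-cofactor s {d} {q} {P} p∤d[s] dq≋ = linear-cancel s (mulP d (quotient s q)) P (begin
    mulP (linear s) (mulP d (quotient s q))     ≈⟨ mulP-Properties.x∙yz≈y∙xz p (linear s) d (quotient s q) ⟩
    mulP d (mulP (linear s) (quotient s q))     ≈⟨ mulP-congˡ d (≋-sym (factor-theorem s q p∣q[s])) ⟩
    mulP d q                                    ≈⟨ dq≋ ⟩
    mulP (linear s) P                           ∎)
    where
    p∣q[s] : p ∣ℤ evalP q (+ s)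
    p∣q[s] = prime-∣ℤ-*ʳ p-prime (evalP d (+ s)) (evalP q (+ s)) p∤d[s]
               (∣ℤ-resp-≡ (evalP-mulP d q (+ s)) (root-of-multiple s P dq≋))

linearProduct : {X : Set} → (X → ℕ) → List X → Poly
linearProduct φ L = prodP (map (λ x → linear (φ x)) L)

module _ {X : Set} (φ : X → ℕ) where

  linearProduct-root : ∀ {m x} L → x ∈ L → m ∣ℤ evalP (linearProduct φ L) (+ φ x)
  linearProduct-root {x = x} L x∈L =
    evalP-prodP-∣ℤ (map (λ y → linear (φ y)) L) (∈-map⁺ (λ y → linear (φ y)) x∈L)
      (∣ℤ-resp-≡ (sym (evalP-linear-root (φ x))) ∣ℤ-zero)

  linearProduct-++ : ∀ {m} A B → linearProduct φ (A ++ B) ≋[ m ] mulP (linearProduct φ A) (linearProduct φ B)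
  linearProduct-++     []      B = ≋-sym (mulP-identityˡ (linearProduct φ B))
  linearProduct-++ {m} (x ∷ A) B = begin
    mulP (linear (φ x)) (linearProduct φ (A ++ B))
      ≈⟨ mulP-congˡ (linear (φ x)) (linearProduct-++ A B) ⟩
    mulP (linear (φ x)) (mulP (linearProduct φ A) (linearProduct φ B))
      ≈⟨ ≋-sym (mulP-assoc (linear (φ x)) (linearProduct φ A) (linearProduct φ B)) ⟩
    mulP (mulP (linear (φ x)) (linearProduct φ A)) (linearProduct φ B)
      ∎
    where open ≋-Reasoning m

  linearProduct-concat : ∀ {m} {I : Set} (R : I → List X) (is : List I) →
    prodP (map (linearProduct φ ∘ R) is) ≋[ m ] linearProduct φ (concat (map R is))
  linearProduct-concat     R []       = ≋-refl
  linearProduct-concat {m} R (i ∷ is) = begin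
    mulP (linearProduct φ (R i)) (prodP (map (linearProduct φ ∘ R) is))
      ≈⟨ mulP-congˡ (linearProduct φ (R i)) (linearProduct-concat R is) ⟩
    mulP (linearProduct φ (R i)) (linearProduct φ (concat (map R is)))
      ≈⟨ ≋-sym (linearProduct-++ (R i) (concat (map R is))) ⟩
    linearProduct φ (R i ++ concat (map R is))
      ∎
    where open ≋-Reasoning m

  module _ {p : ℕ} (p-prime : Prime p) where

    degree-linearProduct : ∀ L → HasDegree p (linearProduct φ L) (length L)
    degree-linearProduct []      = degree-oneP p-prime
    degree-linearProduct (x ∷ L) = degree-mulP p-prime (degree-linear p-prime (φ x)) (degree-linearProduct L)

    linearProduct-root⁻ : ∀ {a} L → p ∣ℤ evalP (linearProduct φ L) a → Any (λ x → p ∣ℤ a - + φ x) L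
    linearProduct-root⁻ {a} []      p∣1 = ⊥-elim (prime∤1 p-prime (∣ℤ-resp-≡ (evalP-oneP a) p∣1))
    linearProduct-root⁻ {a} (x ∷ L) p∣ev
      with prime-∣ℤ-* p-prime _ _ (∣ℤ-resp-≡ (evalP-mulP (linear (φ x)) (linearProduct φ L) a) p∣ev)
    ... | inj₁ p∣a-x = here (∣ℤ-resp-≡ (evalP-linear (φ x) a) p∣a-x)
    ... | inj₂ p∣rest = there (linearProduct-root⁻ L p∣rest)

    divisor-of-linearProduct : ∀ {T : X → Set} (T? : Decidable T) L d q →
      mulP d q ≋[ p ] linearProduct φ L → (∀ x → p ∣ℤ evalP d (+ φ x) → T x) →
      Σ Poly λ w → mulP d w ≋[ p ] linearProduct φ (filter T? L)
    divisor-of-linearProduct T? []      d q dq≋1 _ = q , dq≋1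
    divisor-of-linearProduct {T} T? (x ∷ L) d q dq≋ roots⇒T
      with ∣ℤ? p (evalP d (+ φ x)) | T? x
    ... | yes p∣d[s] | no ¬Tx = ⊥-elim (¬Tx (roots⇒T x p∣d[s]))
    ... | yes p∣d[s] | yes _  =
      let (w , d′w≋) = divisor-of-linearProduct T? L (quotient (φ x) d) q
                         (peel-from-divisor (φ x) {d} {q} {linearProduct φ L} p∣d[s] dq≋) roots-of-d′
      in w , restore-in-divisor (φ x) {d} {w} {linearProduct φ (filter T? L)} p∣d[s] d′w≋
      where
      roots-of-d′ : ∀ y → p ∣ℤ evalP (quotient (φ x) d) (+ φ y) → T y
      roots-of-d′ y p∣d′[y] = roots⇒T y (∣ℤ-resp-mod (evalP-cong (+ φ y) (factor-theorem (φ x) d p∣d[s]))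
        (∣ℤ-resp-≡ (sym (evalP-mulP (linear (φ x)) (quotient (φ x) d) (+ φ y)))
                   (ℤ∣.∣n⇒∣m*n (evalP (linear (φ x)) (+ φ y)) p∣d′[y])))
    ... | no p∤d[s]  | no _  =
      divisor-of-linearProduct T? L d (quotient (φ x) q)
        (peel-from-cofactor p-prime (φ x) {d} {q} {linearProduct φ L} p∤d[s] dq≋) roots⇒T
    ... | no p∤d[s]  | yes _ =
      let (w , dw≋) = divisor-of-linearProduct T? L d (quotient (φ x) q)
                        (peel-from-cofactor p-prime (φ x) {d} {q} {linearProduct φ L} p∤d[s] dq≋) roots⇒T
      in mulP (linear (φ x)) w , restore-in-cofactor (φ x) {d} {w} {linearProduct φ (filter T? L)} dw≋

    Incongruent : List X → Set
    Incongruent = AllPairs (λ x y → ¬ p ∣ℤ + φ x - + φ y)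

    linearProduct-divides : ∀ L {h} → Incongruent L → All (λ x → p ∣ℤ evalP h (+ φ x)) L →
      Σ Poly λ u → mulP (linearProduct φ L) u ≋[ p ] h
    linearProduct-divides []      {h} []               []             = h , mulP-identityˡ h
    linearProduct-divides (x ∷ L) {h} (x≢L ∷ incong-L) (h[s]≡0 ∷ h[L]≡0) =
      let (u , Lu≋h) = linearProduct-divides L incong-L h[L]≡0 in
      quotient s u , extend u Lu≋h
      where
      open ≋-Reasoning p
      s : ℕ
      s = φ x
      -- the cofactor u of ∏ L vanishes at s, which is no root of ∏ L
      extend : ∀ u → mulP (linearProduct φ L) u ≋[ p ] h →
               mulP (linearProduct φ (x ∷ L)) (quotient s u) ≋[ p ] h
      extend u Lu≋h = begin
        mulP (mulP (linear s) (linearProduct φ L)) (quotient s u)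
          ≈⟨ mulP-assoc (linear s) (linearProduct φ L) (quotient s u) ⟩
        mulP (linear s) (mulP (linearProduct φ L) (quotient s u))
          ≈⟨ mulP-Properties.x∙yz≈y∙xz p (linear s) (linearProduct φ L) (quotient s u) ⟩
        mulP (linearProduct φ L) (mulP (linear s) (quotient s u))
          ≈⟨ mulP-congˡ (linearProduct φ L) (≋-sym (factor-theorem s u p∣u[s])) ⟩
        mulP (linearProduct φ L) u
          ≈⟨ Lu≋h ⟩
        h
          ∎
        where
        p∣u[s] : p ∣ℤ evalP u (+ s)
        p∣u[s] = prime-∣ℤ-*ʳ p-prime (evalP (linearProduct φ L) (+ s)) (evalP u (+ s))
                   (λ p∣L[s] → All.All¬⇒¬Any x≢L (linearProduct-root⁻ L p∣L[s]))
                   (∣ℤ-resp-≡ (evalP-mulP (linearProduct φ L) u (+ s))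
                     (∣ℤ-resp-mod (evalP-cong (+ s) Lu≋h) h[s]≡0))

    degMod-linearProduct : ∀ {P} L → P ≋[ p ] linearProduct φ L → degMod p P ≡ length L
    degMod-linearProduct {P} L P≋ =
      degree-unique (degMod-correct p P (degree⇒nonvanishing deg-P)) deg-P
      where
      deg-P : HasDegree p P (length L)
      deg-P = degree-resp-≋ (≋-sym P≋) (degree-linearProduct L)

    root-of? : (t : Poly) → Decidable (λ x → p ∣ℤ evalP t (+ φ x))
    root-of? t x = ∣ℤ? p (evalP t (+ φ x))

    gcd-degree : ∀ {P t h} L → P ≋[ p ] linearProduct φ L → Incongruent L →
                 IsMonicGcd p P t h → degMod p h ≡ length (filter (root-of? t) L)
    gcd-degree {P} {t} {h} L P≋ incong (monic , (q₁ , hq₁≈P) , (q₂ , hq₂≈t) , universal) =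
      ℕ.≤-antisym (degree-≤-of-divisor p-prime deg-h (degree-linearProduct E) (proj₂ h-divides-E))
                  (degree-≤-of-divisor p-prime (degree-linearProduct E) deg-h (proj₂ E-divides-h))
      where
      E : List X
      E = filter (root-of? t) L
      deg-h : HasDegree p h (degMod p h)
      deg-h = degMod-correct p h (monic⇒nonvanishing p-prime {h} monic)
      roots-of-h⇒roots-of-t : ∀ x → p ∣ℤ evalP h (+ φ x) → p ∣ℤ evalP t (+ φ x)
      roots-of-h⇒roots-of-t x p∣h[x] =
        ∣ℤ-resp-mod (evalP-cong (+ φ x) (≋-sym (≈⇒≋ {a = mulP h q₂} {b = t} hq₂≈t)))
        (∣ℤ-resp-≡ (sym (evalP-mulP h q₂ (+ φ x))) (ℤ∣.∣m⇒∣m*n (evalP q₂ (+ φ x)) p∣h[x]))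
      h-divides-E : Σ Poly λ w → mulP h w ≋[ p ] linearProduct φ E
      h-divides-E = divisor-of-linearProduct (root-of? t) L h q₁
                     (≋-trans (≈⇒≋ {a = mulP h q₁} {b = P} hq₁≈P) P≋) roots-of-h⇒roots-of-t
      -- each common root s gives a common factor x - s, hence a factor of h
      common-root : ∀ {x} → x ∈ E → p ∣ℤ evalP h (+ φ x)
      common-root {x} x∈E =
        let (x∈L , p∣t[x]) = ∈-filter⁻ (root-of? t) {xs = L} x∈E
            s = φ x
            p∣P[s] = ∣ℤ-resp-mod (evalP-cong (+ s) P≋) (linearProduct-root L x∈L)
            (w , lin-w≈h) = universal (linear s)
                              (quotient s P , ≋⇒≈ (≋-sym (factor-theorem s P p∣P[s])))
                              (quotient s t , ≋⇒≈ (≋-sym (factor-theorem s t p∣t[x])))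
        in root-of-multiple s w (≋-sym (≈⇒≋ {a = mulP (linear s) w} {b = h} lin-w≈h))
      E-divides-h : Σ Poly λ u → mulP (linearProduct φ E) u ≋[ p ] h
      E-divides-h = linearProduct-divides E (AllPairs.filter⁺ (root-of? t) incong) (All.tabulate common-root)

unique-same-length : ∀ {A : Set} {xs ys : List A} → Unique xs → Unique ys →
                     (∀ {z} → z ∈ xs ⇔ z ∈ ys) → length xs ≡ length ys
unique-same-length xs! ys! same = ↭-length (∼bag⇒↭ (unique∧set⇒bag xs! ys! same))

length-filter-complement : ∀ {A : Set} {P : A → Set} (P? : Decidable P) xs →
  length (filter P? xs) ℕ.+ length (filter (¬? ∘ P?) xs) ≡ length xs
length-filter-complement P? []       = refl
length-filter-complement P? (x ∷ xs) with P? x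
... | yes _ = cong suc (length-filter-complement P? xs)
... | no  _ = trans (ℕ.+-suc _ _) (cong suc (length-filter-complement P? xs))

length-filter-¬ : ∀ {A : Set} {P : A → Set} (P? : Decidable P) xs →
  length (filter (¬? ∘ P?) xs) ≡ length xs ∸ length (filter P? xs)
length-filter-¬ P? xs = sym (trans (cong (_∸ length (filter P? xs)) (sym (length-filter-complement P? xs)))
                                   (ℕ.m+n∸m≡n (length (filter P? xs)) (length (filter (¬? ∘ P?) xs))))

≤-maximum : ∀ {x} xs → x ∈ xs → x ≤ foldr _⊔_ 0 xs
≤-maximum (y ∷ ys) (here refl)  = ℕ.m≤m⊔n y _
≤-maximum (y ∷ ys) (there x∈ys) = ℕ.≤-trans (≤-maximum ys x∈ys) (ℕ.m≤n⊔m y _)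

module DegenerateRoots {p : ℕ} (p-prime : Prime p) (f : Poly) (mult : Fin p → ℕ) where
  open Context p f mult

  Counted : ℕ → Set
  Counted a = (p ∣ ∣ evalP (π p 𝓛₂⋯𝓛ℓ) (+ a) ∣) × ¬ (p ^ 2 ∣ ∣ evalP f (+ a) ∣)

  mult≤ℓ : ∀ r → mult r ≤ ℓ
  mult≤ℓ r = ≤-maximum (map mult (allFin p)) (∈-map⁺ mult (∈-allFin r))

  ∈-rootsOfMult : ∀ r → r ∈ rootsOfMult (mult r)
  ∈-rootsOfMult r = ∈-filter⁺ (λ r′ → mult r′ ℕ.≟ mult r) (∈-allFin r) refl

  ∈-rootsOfMult⁻ : ∀ {r i} → r ∈ rootsOfMult i → mult r ≡ i
  ∈-rootsOfMult⁻ {i = i} r∈ = proj₂ (∈-filter⁻ (λ r′ → mult r′ ℕ.≟ i) {xs = allFin p} r∈)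

  ∈-oneToℓ : ∀ {i} → 1 ≤ i → i ≤ ℓ → i ∈ oneToℓ
  ∈-oneToℓ {suc i} _ i<ℓ = ∈-applyUpTo⁺ suc i<ℓ

  ∈-twoToℓ : ∀ {i} → 2 ≤ i → i ≤ ℓ → i ∈ twoToℓ
  ∈-twoToℓ {suc zero}    (s≤s ()) _
  ∈-twoToℓ {suc (suc i)} _ i+2≤ℓ = ∈-applyUpTo⁺ (λ k → suc (suc k)) (ℕ.∸-monoˡ-≤ 1 i+2≤ℓ)

  ∈-twoToℓ⁻ : ∀ {i} → i ∈ twoToℓ → 2 ≤ i
  ∈-twoToℓ⁻ i∈ with _ , _ , refl ← ∈-applyUpTo⁻ (λ k → suc (suc k)) i∈ = s≤s (s≤s z≤n)

  degenerateRoots : List (Fin p)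
  degenerateRoots = concat (map rootsOfMult twoToℓ)

  ∈-degenerateRoots : ∀ {r} → r ∈ degenerateRoots ⇔ 2 ≤ mult r
  ∈-degenerateRoots {r} = mk⇔ to from
    where
    to : r ∈ degenerateRoots → 2 ≤ mult r
    to r∈ = let (R , r∈R , R∈) = ∈-concat⁻′ (map rootsOfMult twoToℓ) r∈
                (i , i∈ , R≡) = ∈-map⁻ rootsOfMult R∈
            in subst (2 ≤_) (sym (∈-rootsOfMult⁻ (subst (r ∈_) R≡ r∈R))) (∈-twoToℓ⁻ i∈)
    from : 2 ≤ mult r → r ∈ degenerateRoots
    from 2≤mult = ∈-concat⁺′ (∈-rootsOfMult r) (∈-map⁺ rootsOfMult (∈-twoToℓ 2≤mult (mult≤ℓ r)))

  unique-degenerateRoots : Unique degenerateRoots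
  unique-degenerateRoots = Unique.concat⁺
    (All.map⁺ (All.universal (λ i → Unique.filter⁺ (λ r → mult r ℕ.≟ i) (Unique.allFin⁺ p)) twoToℓ))
    (AllPairs.map⁺ (AllPairs.map disjoint (Unique.applyUpTo⁺₁ _ _ λ i<j _ → ℕ.<⇒≢ (s≤s (s≤s i<j)))))
    where
    disjoint : ∀ {i j} → i ≢ j → ∀ {r} → ¬ (r ∈ rootsOfMult i × r ∈ rootsOfMult j)
    disjoint i≢j (r∈i , r∈j) = i≢j (trans (sym (∈-rootsOfMult⁻ r∈i)) (∈-rootsOfMult⁻ r∈j))

  incongruent-degenerateRoots : Incongruent toℕ p-prime degenerateRoots
  incongruent-degenerateRoots = AllPairs.map distinct⇒incongruent unique-degenerateRoots
    where
    distinct⇒incongruent : ∀ {r r′ : Fin p} → r ≢ r′ → ¬ p ∣ℤ + toℕ r - + toℕ r′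
    distinct⇒incongruent r≢r′ p∣r-r′ =
      r≢r′ (Fin.toℕ-injective (residue-unique (Fin.toℕ<n _) (Fin.toℕ<n _) p∣r-r′))

  f₂⋯fℓ-≋ : f₂⋯fℓ ≋[ p ] linearProduct toℕ degenerateRoots
  f₂⋯fℓ-≋ = linearProduct-concat toℕ rootsOfMult twoToℓ

  𝓛-≋ : ∀ i → 𝓛 i ≋[ p ] fᵢ i
  𝓛-≋ i = prodP-map-cong (λ r → π-≋ p (linear (toℕ r))) (rootsOfMult i)

  π𝓛₂⋯𝓛ℓ-≋ : π p 𝓛₂⋯𝓛ℓ ≋[ p ] linearProduct toℕ degenerateRoots
  π𝓛₂⋯𝓛ℓ-≋ = ≋-trans (π-≋ p 𝓛₂⋯𝓛ℓ) (≋-trans (prodP-map-cong 𝓛-≋ twoToℓ) f₂⋯fℓ-≋)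

  degenerate⇔𝓛₂⋯𝓛ℓ-root : ∀ r → 2 ≤ mult r ⇔ p ∣ℤ evalP (π p 𝓛₂⋯𝓛ℓ) (+ toℕ r)
  degenerate⇔𝓛₂⋯𝓛ℓ-root r = mk⇔ to from
    where
    x : ℤ
    x = + toℕ r
    to : 2 ≤ mult r → p ∣ℤ evalP (π p 𝓛₂⋯𝓛ℓ) x
    to 2≤mult = ∣ℤ-resp-mod (evalP-cong x π𝓛₂⋯𝓛ℓ-≋)
      (linearProduct-root toℕ degenerateRoots (Equivalence.from ∈-degenerateRoots 2≤mult))
    from : p ∣ℤ evalP (π p 𝓛₂⋯𝓛ℓ) x → 2 ≤ mult r
    from p∣ev =
      let (r′ , r′∈ , p∣r-r′) = find (linearProduct-root⁻ toℕ p-prime degenerateRoots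
                                        (∣ℤ-resp-mod (evalP-cong x (≋-sym π𝓛₂⋯𝓛ℓ-≋)) p∣ev))
          r≡r′ = Fin.toℕ-injective (residue-unique (Fin.toℕ<n r) (Fin.toℕ<n r′) p∣r-r′)
      in Equivalence.to ∈-degenerateRoots (subst (_∈ degenerateRoots) (sym r≡r′) r′∈)

  module Lifting (g : Poly) (factorisation : h₁ ≈[ p ] mulP fPowers g) where

    M : Poly
    M = mulP (lift p g) 𝓛Powers

    T : Poly
    T = map (divBy p) (subP f M)

    f-≋-M : f ≋[ p ] M
    f-≋-M = begin
      f                          ≈⟨ ≋-sym (π-≋ p f) ⟩
      h₁                         ≈⟨ ≈⇒≋ {a = h₁} {b = mulP fPowers g} factorisation ⟩
      mulP fPowers g             ≈⟨ mulP-comm fPowers g ⟩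
      mulP g fPowers             ≈⟨ mulP-cong (≋-sym (π-≋ p g)) (≋-sym 𝓛Powers-≋) ⟩
      M                          ∎
      where
      open ≋-Reasoning p
      𝓛Powers-≋ : 𝓛Powers ≋[ p ] fPowers
      𝓛Powers-≋ = prodP-map-cong (λ i → powP-cong (𝓛-≋ i) i) oneToℓ

    p∣f-M : ∀ n → p ∣ℤ coeff (subP f M) n
    p∣f-M n = ∣ℤ-resp-≡ (sym (trans (coeff-addP f (map -_ M) n) (cong (_+_ (coeff f n)) (coeff-map -_ refl M n))))
                        (difference (at f-≋-M n))

    f-decomposition : ∀ x → evalP f x ≡ + p * evalP T x + evalP M x
    f-decomposition x = begin
      evalP f x                              ≡⟨ regroup (evalP f x) (evalP M x) ⟩
      (evalP f x - evalP M x) + evalP M x    ≡⟨ cong (_+ evalP M x) (sym (evalP-subP f M x)) ⟩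
      evalP (subP f M) x + evalP M x         ≡⟨ cong (_+ evalP M x) (evalP-divBy p (subP f M) x p∣f-M) ⟩
      + p * evalP T x + evalP M x            ∎
      where
      open ≡-Reasoning
      regroup : ∀ a b → a ≡ (a - b) + b
      regroup = solve-∀

    -- At a degenerate root r, the factor 𝓛_(mult r)^(mult r) makes M(r) divisible by p².
    p²∣M : ∀ r → 2 ≤ mult r → p ℕ.* p ∣ℤ evalP M (+ toℕ r)
    p²∣M r 2≤mult = ∣ℤ-resp-≡ (sym (evalP-mulP (lift p g) 𝓛Powers x))
      (ℤ∣.∣n⇒∣m*n (evalP (lift p g) x)
        (evalP-prodP-∣ℤ (map (λ i → powP (𝓛 i) i) oneToℓ)
          (∈-map⁺ (λ i → powP (𝓛 i) i) (∈-oneToℓ (ℕ.≤-trans (s≤s z≤n) 2≤mult) (mult≤ℓ r)))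
          (evalP-powP-square (𝓛 (mult r)) x 2≤mult p∣𝓛[r])))
      where
      x : ℤ
      x = + toℕ r
      p∣𝓛[r] : p ∣ℤ evalP (𝓛 (mult r)) x
      p∣𝓛[r] = ∣ℤ-resp-mod (evalP-cong x (𝓛-≋ (mult r)))
                            (linearProduct-root toℕ (rootsOfMult (mult r)) (∈-rootsOfMult r))

    lifts⇔t-root : ∀ r → 2 ≤ mult r → (p ^ 2 ∣ ∣ evalP f (+ toℕ r) ∣) ⇔ p ∣ℤ evalP (t g) (+ toℕ r)
    lifts⇔t-root r 2≤mult = mk⇔
      (λ p²∣f → ∣ℤ-resp-mod t≡T (∣ℤ-cancel-factor (evalP T x)
                  (∣ℤ-resp-mod (mod-sym f≡pT) (∣∣∣⇒∣ℤ (subst (_∣ ∣ evalP f x ∣) p^2≡p*p p²∣f)))))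
      (λ p∣t → subst (_∣ ∣ evalP f x ∣) (sym p^2≡p*p) (∣ℤ⇒∣∣∣ (∣ℤ-resp-mod f≡pT
                  (∣ℤ-product-of-multiples (ℤ∣.∣-refl {+ p}) (∣ℤ-resp-mod (mod-sym t≡T) p∣t)))))
      where
      instance _ = ℕ.prime⇒nonZero p-prime
      x : ℤ
      x = + toℕ r
      p^2≡p*p : p ^ 2 ≡ p ℕ.* p
      p^2≡p*p = cong (p ℕ.*_) (ℕ.*-identityʳ p)
      t≡T : evalP (t g) x ≡[ p ] evalP T x
      t≡T = evalP-cong x (π-≋ p T)
      f≡pT : evalP f x ≡[ p ℕ.* p ] + p * evalP T x
      f≡pT = mod-trans (≡⇒≡-mod (f-decomposition x)) (+-absorbʳ-mod (+ p * evalP T x) (p²∣M r 2≤mult))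

    t-root? : Decidable (λ (r : Fin p) → p ∣ℤ evalP (t g) (+ toℕ r))
    t-root? = root-of? toℕ p-prime (t g)

    counted⇔ : ∀ r → Counted (toℕ r) ⇔ (r ∈ degenerateRoots × ¬ p ∣ℤ evalP (t g) (+ toℕ r))
    counted⇔ r = mk⇔
      (λ (p∣𝓛 , p²∤f) →
         let 2≤mult = Equivalence.from (degenerate⇔𝓛₂⋯𝓛ℓ-root r) (∣∣∣⇒∣ℤ p∣𝓛) in
         Equivalence.from ∈-degenerateRoots 2≤mult ,
         p²∤f ∘ Equivalence.from (lifts⇔t-root r 2≤mult))
      (λ (r∈ , p∤t) →
         let 2≤mult = Equivalence.to ∈-degenerateRoots r∈ in
         ∣ℤ⇒∣∣∣ (Equivalence.to (degenerate⇔𝓛₂⋯𝓛ℓ-root r) 2≤mult) ,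
         p∤t ∘ Equivalence.to (lifts⇔t-root r 2≤mult))

    nonliftingRoots : List (Fin p)
    nonliftingRoots = filter (¬? ∘ t-root?) degenerateRoots

    badCount-≡ : badCount ≡ length nonliftingRoots
    badCount-≡ = trans
      (unique-same-length {xs = filter badRoot? (upTo p)} {ys = map toℕ nonliftingRoots}
         (Unique.filter⁺ badRoot? (Unique.upTo⁺ p))
         (Unique.map⁺ (λ {r r′ : Fin p} → Fin.toℕ-injective {i = r} {j = r′})
                      (Unique.filter⁺ (¬? ∘ t-root?) unique-degenerateRoots))
         (mk⇔ to from))
      (length-map toℕ nonliftingRoots)
      where
      to : ∀ {a} → a ∈ filter badRoot? (upTo p) → a ∈ map toℕ nonliftingRoots
      to {a} a∈ =
        let (a∈upTo , bad) = ∈-filter⁻ badRoot? {xs = upTo p} a∈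
            a<p = ∈-upTo⁻ a∈upTo
            r = fromℕ< a<p
            toℕr≡a = Fin.toℕ-fromℕ< a<p
            (r∈ , p∤t) = Equivalence.to (counted⇔ r) (subst Counted (sym toℕr≡a) bad)
        in subst (_∈ map toℕ nonliftingRoots) toℕr≡a (∈-map⁺ toℕ (∈-filter⁺ (¬? ∘ t-root?) r∈ p∤t))
      from : ∀ {a} → a ∈ map toℕ nonliftingRoots → a ∈ filter badRoot? (upTo p)
      from a∈ =
        let (r , r∈′ , a≡r) = ∈-map⁻ toℕ a∈
            (r∈ , p∤t) = ∈-filter⁻ (¬? ∘ t-root?) {xs = degenerateRoots} r∈′
        in subst (_∈ filter badRoot? (upTo p)) (sym a≡r)
             (∈-filter⁺ badRoot? (∈-upTo⁺ (Fin.toℕ<n r)) (Equivalence.from (counted⇔ r) (r∈ , p∤t)))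

-- The corollary.
corollary3p3 : (f : Poly) (p : ℕ) → Prime p → NonConstant f →
    ¬ (∀ n → p ∣ ∣ coeff f n ∣) →
    (mult : Fin p → ℕ) →
    (∀ r → IsMultiplicity p (Context.h₁ p f mult) (toℕ r) (mult r)) →
    (g : Poly) → Context.h₁ p f mult ≈[ p ] mulP (Context.fPowers p f mult) g →
    (h₂ : Poly) →
    IsMonicGcd p (Context.f₂⋯fℓ p f mult) (Context.t p f mult g) h₂ →
    Context.badCount p f mult
      ≡ degMod p (Context.f₂⋯fℓ p f mult) ∸ degMod p h₂
corollary3p3 f p p-prime _ _ mult _ g factorisation h₂ isGcd = begin
  badCount
    ≡⟨ badCount-≡ ⟩
  length nonliftingRoots
    ≡⟨ length-filter-¬ t-root? degenerateRoots ⟩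
  length degenerateRoots ∸ length (filter t-root? degenerateRoots)
    ≡⟨ cong₂ _∸_ (sym deg-f₂⋯fℓ) (sym deg-h₂) ⟩
  degMod p f₂⋯fℓ ∸ degMod p h₂
    ∎
  where
  open ≡-Reasoning
  open Context p f mult
  open DegenerateRoots p-prime f mult
  open Lifting g factorisation
  deg-f₂⋯fℓ : degMod p f₂⋯fℓ ≡ length degenerateRoots
  deg-f₂⋯fℓ = degMod-linearProduct toℕ p-prime degenerateRoots f₂⋯fℓ-≋
  deg-h₂ : degMod p h₂ ≡ length (filter t-root? degenerateRoots)
  deg-h₂ = gcd-degree toℕ p-prime {t = t g} {h = h₂} degenerateRoots
                      f₂⋯fℓ-≋ incongruent-degenerateRoots isGcd
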